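{- Let $n$ be sufficiently large and let $G$ be a $C_3^{(3)}$-saturated $3$-uniform hypergraph on $n$ vertices with exactly $\mathrm{sat}_3(n,C_3^{(3)})$ edges. Let $v\in V(G)$. Then no edge $e\in E(G)$ with $v\notin e$ contains two vertices of degree $2$ that both belong to $N(v)$.
   Context: $C_3^{(3)}$ is the $3$-uniform loose cycle with three edges (vertices $v_1,\dots,v_6$, edges $\{v_1,v_2,v_3\},\{v_3,v_4,v_5\},\{v_5,v_6,v_1\}$). $G$ is $C_3^{(3)}$-saturated if it contains no copy of $C_3^{(3)}$ but adding any $3$-set that is not an edge creates one; $\mathrm{sat}_3(n,C_3^{(3)})$ is the minimum number of edges of such an $n$-vertex $3$-uniform hypergraph. The degree of a vertex is the number of edges containing it. $N(v)$ is the set of vertices $u\neq v$ such that some edge contains both $u$ and $v$. -}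

module Defs where

open import Data.Nat using (ℕ; _≤_)
open import Data.Fin using (Fin)
open import Data.Fin.Subset using (Subset; _∈_; _∉_; ∣_∣; ⁅_⁆; _∪_)
open import Data.Fin.Subset.Properties using (_∈?_)
open import Data.List using (List; _∷_; length; filter)
open import Data.List.Relation.Unary.All using (All)
open import Data.List.Relation.Unary.Unique.Propositional using (Unique)
import Data.List.Membership.Propositional as LM
open import Data.Product using (Σ; _×_; ∃-syntax)
open import Relation.Binary.PropositionalEquality using (_≡_; _≢_)
open import Relation.Nullary using (¬_)

record Hyp3 (n : ℕ) : Set where
  field
    edges    : List (Subset n)
    unique   : Unique edges
    uniform  : All (λ e → ∣ e ∣ ≡ 3) edges
open Hyp3 public

_∈E_ : ∀ {n} → Subset n → Hyp3 n → Set
e ∈E G = e LM.∈ edges G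

numEdges : ∀ {n} → Hyp3 n → ℕ
numEdges G = length (edges G)

triple : ∀ {n} → Fin n → Fin n → Fin n → Subset n
triple a b c = ⁅ a ⁆ ∪ (⁅ b ⁆ ∪ ⁅ c ⁆)

ContainsC3 : ∀ {n} → List (Subset n) → Set
ContainsC3 {n} E =
  Σ (Fin n) λ v1 → Σ (Fin n) λ v2 → Σ (Fin n) λ v3 →
  Σ (Fin n) λ v4 → Σ (Fin n) λ v5 → Σ (Fin n) λ v6 →
    (v1 ≢ v2) × (v1 ≢ v3) × (v1 ≢ v4) × (v1 ≢ v5) × (v1 ≢ v6) ×
    (v2 ≢ v3) × (v2 ≢ v4) × (v2 ≢ v5) × (v2 ≢ v6) ×
    (v3 ≢ v4) × (v3 ≢ v5) × (v3 ≢ v6) ×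
    (v4 ≢ v5) × (v4 ≢ v6) ×
    (v5 ≢ v6) ×
    (triple v1 v2 v3 LM.∈ E) × (triple v3 v4 v5 LM.∈ E) × (triple v5 v6 v1 LM.∈ E)

Saturated : ∀ {n} → Hyp3 n → Set
Saturated {n} G =
  ¬ ContainsC3 (edges G) ×
  (∀ (s : Subset n) → ∣ s ∣ ≡ 3 → ¬ (s ∈E G) → ContainsC3 (s ∷ edges G))

ExtremalSaturated : ∀ {n} → Hyp3 n → Set
ExtremalSaturated {n} G =
  Saturated G × (∀ (H : Hyp3 n) → Saturated H → numEdges G ≤ numEdges H)

degree : ∀ {n} → Hyp3 n → Fin n → ℕ
degree G v = length (filter (v ∈?_) (edges G))

InNbhd : ∀ {n} → Hyp3 n → Fin n → Fin n → Set
InNbhd G v u = (u ≢ v) × ∃[ e ] ((e ∈E G) × (v ∈ e) × (u ∈ e))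

{-# OPTIONS --safe #-}
module Submission where

-- Let f be an edge through u and v, and put s = {u, w, z} for a third vertex z chosen so
-- that s is not an edge: z = v if w ∉ f, and otherwise z outside e ∪ f (this needs n ≥ 7).
-- As u and w have degree 2, every edge through u or w meets s in a second vertex.  In a
-- loose triangle using s, however, the edge at a vertex shared with s meets s only there,
-- and one of u, w is such a shared vertex.  So adding s creates no C₃⁽³⁾, contradicting
-- saturation.

open import Defs
open import Data.Nat using (ℕ; suc; _+_; _≤_; _<_; _≥_; s≤s; z≤n)
open import Data.Nat.Properties using (≤-trans; ≤-reflexive; +-suc; +-monoʳ-≤; n≤1+n; <⇒≱)
open import Data.Fin using (Fin)
open import Data.Fin.Properties using (¬∀⟶∃¬)
open import Data.Fin.Subset using (Subset; _∈_; _∉_; ∣_∣; ⁅_⁆; _∪_; ⊤; inside; outside)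
open import Data.Fin.Subset.Properties
  using (_∈?_; x∈⁅x⁆; x∈⁅y⁆⇒x≡y; x≢y⇒x∉⁅y⁆; x∈p∪q⁻; x∈p∪q⁺; ∣⁅x⁆∣≡1; ∪-identityˡ; ∣⊤∣≡n; p⊆q⇒∣p∣≤∣q∣)
open import Data.Vec using ([]; _∷_; here; there)
open import Data.List using (List; []; _∷_; length; filter)
open import Data.List.Membership.Propositional using () renaming (_∈_ to _∈ₗ_)
open import Data.List.Membership.Propositional.Properties using (∈-filter⁺)
open import Data.List.Relation.Unary.Any using (here; there)
open import Data.List.Relation.Unary.All using (lookup)
open import Data.Product using (Σ; ∃; ∃₂; _,_; _×_)
open import Data.Sum using (_⊎_; inj₁; inj₂)
open import Data.Empty using (⊥; ⊥-elim)
open import Function using (_∘_; case_of_)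
open import Relation.Binary.PropositionalEquality using (_≡_; _≢_; refl; sym; trans; subst; cong; cong₂; ≢-sym)
open import Relation.Nullary using (¬_; yes; no)

private
  variable
    n : ℕ
    a b c p q x : Fin n
    s t : Subset n
    E : List (Subset n)

∈-triple⁻ : x ∈ triple a b c → x ≡ a ⊎ x ≡ b ⊎ x ≡ c
∈-triple⁻ {a = a} {b} {c} x∈abc with x∈p∪q⁻ ⁅ a ⁆ (⁅ b ⁆ ∪ ⁅ c ⁆) x∈abc
... | inj₁ x∈a = inj₁ (x∈⁅y⁆⇒x≡y a x∈a)
... | inj₂ x∈bc with x∈p∪q⁻ ⁅ b ⁆ ⁅ c ⁆ x∈bc
...   | inj₁ x∈b = inj₂ (inj₁ (x∈⁅y⁆⇒x≡y b x∈b))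
...   | inj₂ x∈c = inj₂ (inj₂ (x∈⁅y⁆⇒x≡y c x∈c))

a∈triple : ∀ (a b c : Fin n) → a ∈ triple a b c
a∈triple a b c = x∈p∪q⁺ (inj₁ (x∈⁅x⁆ a))

b∈triple : ∀ (a b c : Fin n) → b ∈ triple a b c
b∈triple a b c = x∈p∪q⁺ (inj₂ (x∈p∪q⁺ (inj₁ (x∈⁅x⁆ b))))

c∈triple : ∀ (a b c : Fin n) → c ∈ triple a b c
c∈triple a b c = x∈p∪q⁺ (inj₂ (x∈p∪q⁺ (inj₂ (x∈⁅x⁆ c))))

∈-triple-rotate : x ∈ triple a b c → x ∈ triple c a b
∈-triple-rotate {a = a} {b} {c} x∈abc with ∈-triple⁻ x∈abc
... | inj₁ refl        = b∈triple c a b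
... | inj₂ (inj₁ refl) = c∈triple c a b
... | inj₂ (inj₂ refl) = a∈triple c a b

∉-triple : x ≢ a → x ≢ b → x ≢ c → x ∉ triple a b c
∉-triple x≢a x≢b x≢c x∈abc with ∈-triple⁻ x∈abc
... | inj₁ x≡a        = x≢a x≡a
... | inj₂ (inj₁ x≡b) = x≢b x≡b
... | inj₂ (inj₂ x≡c) = x≢c x≡c

triple-meets-only-first : x ∈ triple a b c → b ∉ t → c ∉ t → x ∈ t → x ≡ a
triple-meets-only-first x∈abc b∉t c∉t x∈t with ∈-triple⁻ x∈abc
... | inj₁ x≡a        = x≡a
... | inj₂ (inj₁ refl) = ⊥-elim (b∉t x∈t)
... | inj₂ (inj₂ refl) = ⊥-elim (c∉t x∈t)

∣⁅x⁆∪p∣≡1+∣p∣ : ∀ (x : Fin n) (p : Subset n) → x ∉ p → ∣ ⁅ x ⁆ ∪ p ∣ ≡ suc ∣ p ∣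
∣⁅x⁆∪p∣≡1+∣p∣ Fin.zero    (inside  ∷ p) x∉p = ⊥-elim (x∉p here)
∣⁅x⁆∪p∣≡1+∣p∣ Fin.zero    (outside ∷ p) _   = cong (suc ∘ ∣_∣) (∪-identityˡ p)
∣⁅x⁆∪p∣≡1+∣p∣ (Fin.suc x) (inside  ∷ p) x∉p = cong suc (∣⁅x⁆∪p∣≡1+∣p∣ x p (x∉p ∘ there))
∣⁅x⁆∪p∣≡1+∣p∣ (Fin.suc x) (outside ∷ p) x∉p = ∣⁅x⁆∪p∣≡1+∣p∣ x p (x∉p ∘ there)

∣triple∣≡3 : a ≢ b → a ≢ c → b ≢ c → ∣ triple a b c ∣ ≡ 3
∣triple∣≡3 {a = a} {b} {c} a≢b a≢c b≢c =
  trans (∣⁅x⁆∪p∣≡1+∣p∣ a (⁅ b ⁆ ∪ ⁅ c ⁆) a∉bc)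
        (cong suc (trans (∣⁅x⁆∪p∣≡1+∣p∣ b ⁅ c ⁆ (x≢y⇒x∉⁅y⁆ b≢c)) (cong suc (∣⁅x⁆∣≡1 c))))
  where
  a∉bc : a ∉ ⁅ b ⁆ ∪ ⁅ c ⁆
  a∉bc a∈bc with x∈p∪q⁻ ⁅ b ⁆ ⁅ c ⁆ a∈bc
  ... | inj₁ a∈b = a≢b (x∈⁅y⁆⇒x≡y b a∈b)
  ... | inj₂ a∈c = a≢c (x∈⁅y⁆⇒x≡y c a∈c)

∣p∪q∣≤∣p∣+∣q∣ : ∀ (p q : Subset n) → ∣ p ∪ q ∣ ≤ ∣ p ∣ + ∣ q ∣
∣p∪q∣≤∣p∣+∣q∣ []            []            = z≤n
∣p∪q∣≤∣p∣+∣q∣ (outside ∷ p) (outside ∷ q) = ∣p∪q∣≤∣p∣+∣q∣ p q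
∣p∪q∣≤∣p∣+∣q∣ (outside ∷ p) (inside  ∷ q) =
  ≤-trans (s≤s (∣p∪q∣≤∣p∣+∣q∣ p q)) (≤-reflexive (sym (+-suc ∣ p ∣ ∣ q ∣)))
∣p∪q∣≤∣p∣+∣q∣ (inside  ∷ p) (outside ∷ q) = s≤s (∣p∪q∣≤∣p∣+∣q∣ p q)
∣p∪q∣≤∣p∣+∣q∣ (inside  ∷ p) (inside  ∷ q) =
  s≤s (≤-trans (∣p∪q∣≤∣p∣+∣q∣ p q) (+-monoʳ-≤ ∣ p ∣ (n≤1+n ∣ q ∣)))

∣p∣<n⇒∃∉ : ∀ (p : Subset n) → ∣ p ∣ < n → ∃ λ x → x ∉ p
∣p∣<n⇒∃∉ {n} p ∣p∣<n = ¬∀⟶∃¬ n (_∈ p) (_∈? p) all∉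
  where
  all∉ : ¬ (∀ x → x ∈ p)
  all∉ all∈ = <⇒≱ ∣p∣<n (subst (_≤ ∣ p ∣) (∣⊤∣≡n n) (p⊆q⇒∣p∣≤∣q∣ {p = ⊤} (λ {x} _ → all∈ x)))

length≡2⇒∈-pair : ∀ {A : Set} (xs : List A) → length xs ≡ 2 →
  ∃₂ λ y z → ∀ {x} → x ∈ₗ xs → x ≡ y ⊎ x ≡ z
length≡2⇒∈-pair (y ∷ z ∷ []) refl = y , z , λ { (here x≡y) → inj₁ x≡y ; (there (here x≡z)) → inj₂ x≡z }

degree≡2⇒edge≡⊎≡ : ∀ {G : Hyp3 n} {e f g} → degree G p ≡ 2 →
  e ∈E G → p ∈ e → f ∈E G → p ∈ f → e ≢ f → g ∈E G → p ∈ g → g ≡ e ⊎ g ≡ f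
degree≡2⇒edge≡⊎≡ {p = p} {G} deg e∈G p∈e f∈G p∈f e≢f g∈G p∈g
  with length≡2⇒∈-pair (filter (p ∈?_) (edges G)) deg
... | y , z , pair
  with pair (∈-filter⁺ (p ∈?_) e∈G p∈e) | pair (∈-filter⁺ (p ∈?_) f∈G p∈f) | pair (∈-filter⁺ (p ∈?_) g∈G p∈g)
... | inj₁ e≡y | inj₁ f≡y | _        = ⊥-elim (e≢f (trans e≡y (sym f≡y)))
... | inj₂ e≡z | inj₂ f≡z | _        = ⊥-elim (e≢f (trans e≡z (sym f≡z)))
... | inj₁ e≡y | inj₂ _   | inj₁ g≡y = inj₁ (trans g≡y (sym e≡y))
... | inj₁ _   | inj₂ f≡z | inj₂ g≡z = inj₂ (trans g≡z (sym f≡z))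
... | inj₂ _   | inj₁ f≡y | inj₁ g≡y = inj₂ (trans g≡y (sym f≡y))
... | inj₂ e≡z | inj₁ _   | inj₂ g≡z = inj₁ (trans g≡z (sym e≡z))

SharesOther : Subset n → Fin n → Subset n → Set
SharesOther {n} s p g = Σ (Fin n) λ q → q ≢ p × q ∈ s × q ∈ g

Anchored : List (Subset n) → Subset n → Fin n → Set
Anchored E s p = ∀ {g} → g ∈ₗ E → p ∈ g → SharesOther s p g

anchored-of-degree≡2 : ∀ {G : Hyp3 n} {e f} → degree G p ≡ 2 →
  e ∈E G → p ∈ e → f ∈E G → p ∈ f → e ≢ f →
  SharesOther s p e → SharesOther s p f → Anchored (edges G) s p
anchored-of-degree≡2 {G = G} deg e∈G p∈e f∈G p∈f e≢f shares-e shares-f g∈G p∈g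
  with degree≡2⇒edge≡⊎≡ {G = G} deg e∈G p∈e f∈G p∈f e≢f g∈G p∈g
... | inj₁ refl = shares-e
... | inj₂ refl = shares-f

rotate : ContainsC3 E → ContainsC3 E
rotate (v1 , v2 , v3 , v4 , v5 , v6 , d12 , d13 , d14 , d15 , d16 , d23 , d24 , d25 , d26 ,
        d34 , d35 , d36 , d45 , d46 , d56 , m123 , m345 , m561) =
  v3 , v4 , v5 , v6 , v1 , v2 , d34 , d35 , d36 , ≢-sym d13 , ≢-sym d23 , d45 , d46 ,
  ≢-sym d14 , ≢-sym d24 , d56 , ≢-sym d15 , ≢-sym d25 , ≢-sym d16 , ≢-sym d26 , d12 ,
  m345 , m561 , m123

firstEdge : {E : List (Subset n)} → ContainsC3 E → Subset n
firstEdge (v1 , v2 , v3 , _) = triple v1 v2 v3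

-- Used with f the cycle edge at a vertex p shared with s, which meets s only in p.
shared-vertex-not-anchored : ∀ {f} → Anchored E s p → f ∈ₗ s ∷ E → p ∈ f →
  (∀ {x} → x ∈ s → x ∈ f → x ≡ p) → q ∈ s → q ≢ p → ⊥
shared-vertex-not-anchored _    (here refl)  _   meets-only-p q∈s q≢p = q≢p (meets-only-p q∈s q∈s)
shared-vertex-not-anchored anch (there f∈E) p∈f meets-only-p _   _
  with anch f∈E p∈f
... | q , q≢p , q∈s , q∈f = q≢p (meets-only-p q∈s q∈f)

first-edge-≢-anchored-pair : ∀ {u w} → u ≢ w → u ∈ s → w ∈ s →
  Anchored E s u → Anchored E s w → (C : ContainsC3 (s ∷ E)) → firstEdge C ≢ s
first-edge-≢-anchored-pair {s = s} {E} {u} {w} u≢w u∈s w∈s anch-u anch-w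
  (v1 , v2 , v3 , v4 , v5 , v6 , d12 , d13 , d14 , d15 , d16 , d23 , d24 , d25 , d26 ,
   d34 , d35 , d36 , d45 , d46 , d56 , _ , m345 , m561) refl
  = by-position (∈-triple⁻ u∈s) (∈-triple⁻ w∈s)
  where
  at-v1 : Anchored E s v1 → ⊥
  at-v1 anch = shared-vertex-not-anchored anch m561 (c∈triple v5 v6 v1)
    (λ x∈s → triple-meets-only-first x∈s (∉-triple d25 d26 (≢-sym d12)) (∉-triple d35 d36 (≢-sym d13)))
    (b∈triple v1 v2 v3) (≢-sym d12)
  at-v3 : Anchored E s v3 → ⊥
  at-v3 anch = shared-vertex-not-anchored anch m345 (a∈triple v3 v4 v5)
    (λ x∈s → triple-meets-only-first (∈-triple-rotate x∈s) (∉-triple d13 d14 d15) (∉-triple d23 d24 d25))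
    (b∈triple v1 v2 v3) d23
  at-shared : ∀ {p} → p ≡ v1 ⊎ p ≡ v3 → Anchored E s p → ⊥
  at-shared (inj₁ refl) = at-v1
  at-shared (inj₂ refl) = at-v3
  by-position : u ≡ v1 ⊎ u ≡ v2 ⊎ u ≡ v3 → w ≡ v1 ⊎ w ≡ v2 ⊎ w ≡ v3 → ⊥
  by-position (inj₁ u≡v1)        _                  = at-shared (inj₁ u≡v1) anch-u
  by-position (inj₂ (inj₂ u≡v3)) _                  = at-shared (inj₂ u≡v3) anch-u
  by-position (inj₂ (inj₁ _))    (inj₁ w≡v1)        = at-shared (inj₁ w≡v1) anch-w
  by-position (inj₂ (inj₁ _))    (inj₂ (inj₂ w≡v3)) = at-shared (inj₂ w≡v3) anch-w
  by-position (inj₂ (inj₁ u≡v2)) (inj₂ (inj₁ w≡v2)) = u≢w (trans u≡v2 (sym w≡v2))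

∷-preserves-¬C3 : ∀ {E : List (Subset n)} {s u w} → ¬ ContainsC3 E → u ≢ w → u ∈ s → w ∈ s →
  Anchored E s u → Anchored E s w → ¬ ContainsC3 (s ∷ E)
∷-preserves-¬C3 {E = E} {s = s} ¬C3 u≢w u∈s w∈s anch-u anch-w = new-cycle-impossible
  where
  not-first : (C : ContainsC3 (s ∷ E)) → firstEdge C ≢ s
  not-first = first-edge-≢-anchored-pair u≢w u∈s w∈s anch-u anch-w
  new-cycle-impossible : ¬ ContainsC3 (s ∷ E)
  new-cycle-impossible
    C@(v1 , v2 , v3 , v4 , v5 , v6 , d12 , d13 , d14 , d15 , d16 , d23 , d24 , d25 , d26 ,
       d34 , d35 , d36 , d45 , d46 , d56 , m123 , m345 , m561)
    with m123 | m345 | m561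
  ... | here eq     | _           | _           = not-first C eq
  ... | there _     | here eq     | _           = not-first (rotate C) eq
  ... | there _     | there _     | here eq     = not-first (rotate (rotate C)) eq
  ... | there m123′ | there m345′ | there m561′ =
    ¬C3 (v1 , v2 , v3 , v4 , v5 , v6 , d12 , d13 , d14 , d15 , d16 , d23 , d24 , d25 , d26 ,
         d34 , d35 , d36 , d45 , d46 , d56 , m123′ , m345′ , m561′)

saturated⇒¬anchored-pair : ∀ {G : Hyp3 n} {u w} → Saturated G → ∣ s ∣ ≡ 3 → ¬ s ∈E G →
  u ≢ w → u ∈ s → w ∈ s → Anchored (edges G) s u → Anchored (edges G) s w → ⊥
saturated⇒¬anchored-pair (¬C3 , saturate) ∣s∣≡3 s∉G u≢w u∈s w∈s anch-u anch-w =
  ∷-preserves-¬C3 ¬C3 u≢w u∈s w∈s anch-u anch-w (saturate _ ∣s∣≡3 s∉G)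

vertex-outside-two-edges : ∀ {G : Hyp3 n} {e f} → 7 ≤ n → e ∈E G → f ∈E G →
  ∃ λ z → z ∉ e × z ∉ f
vertex-outside-two-edges {n} {G} {e} {f} 7≤n e∈G f∈G =
  let z , z∉e∪f = ∣p∣<n⇒∃∉ (e ∪ f) (≤-trans (s≤s ∣e∪f∣≤6) 7≤n)
  in  z , z∉e∪f ∘ x∈p∪q⁺ ∘ inj₁ , z∉e∪f ∘ x∈p∪q⁺ ∘ inj₂
  where
  ∣e∪f∣≤6 : ∣ e ∪ f ∣ ≤ 6
  ∣e∪f∣≤6 = ≤-trans (∣p∪q∣≤∣p∣+∣q∣ e f)
    (≤-reflexive (cong₂ _+_ (lookup (uniform G) e∈G) (lookup (uniform G) f∈G)))

saturated⇒¬degree-2-pair-in-two-edges : ∀ {G : Hyp3 n} {e f u w} → 7 ≤ n → Saturated G →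
  e ∈E G → f ∈E G → e ≢ f → u ≢ w → u ∈ e → w ∈ e → u ∈ f → w ∈ f →
  degree G u ≡ 2 → degree G w ≡ 2 → ⊥
saturated⇒¬degree-2-pair-in-two-edges {G = G} {e} {f} {u} {w}
  7≤n sat e∈G f∈G e≢f u≢w u∈e w∈e u∈f w∈f deg-u deg-w
  with vertex-outside-two-edges {G = G} 7≤n e∈G f∈G
... | z , z∉e , z∉f =
  saturated⇒¬anchored-pair {G = G} sat (∣triple∣≡3 u≢w u≢z w≢z) s∉G u≢w (a∈triple u w z) (b∈triple u w z)
    (anchored-of-degree≡2 {G = G} deg-u e∈G u∈e f∈G u∈f e≢f (w , ≢-sym u≢w , b∈triple u w z , w∈e)
                                                      (w , ≢-sym u≢w , b∈triple u w z , w∈f))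
    (anchored-of-degree≡2 {G = G} deg-w e∈G w∈e f∈G w∈f e≢f (u , u≢w , a∈triple u w z , u∈e)
                                                      (u , u≢w , a∈triple u w z , u∈f))
  where
  u≢z : u ≢ z
  u≢z u≡z = z∉e (subst (_∈ e) u≡z u∈e)
  w≢z : w ≢ z
  w≢z w≡z = z∉e (subst (_∈ e) w≡z w∈e)
  s∉G : ¬ triple u w z ∈E G
  s∉G s∈G with degree≡2⇒edge≡⊎≡ {G = G} deg-u e∈G u∈e f∈G u∈f e≢f s∈G (a∈triple u w z)
  ... | inj₁ refl = z∉e (c∈triple u w z)
  ... | inj₂ refl = z∉f (c∈triple u w z)

saturated⇒¬degree-2-pair-with-common-neighbour : ∀ {G : Hyp3 n} {e f g u w v} → Saturated G →
  e ∈E G → f ∈E G → g ∈E G → u ≢ w → u ≢ v → w ≢ v →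
  u ∈ e → w ∈ e → v ∉ e → u ∈ f → v ∈ f → w ∉ f → w ∈ g → v ∈ g →
  degree G u ≡ 2 → degree G w ≡ 2 → ⊥
saturated⇒¬degree-2-pair-with-common-neighbour {G = G} {e} {f} {g} {u} {w} {v}
  sat e∈G f∈G g∈G u≢w u≢v w≢v u∈e w∈e v∉e u∈f v∈f w∉f w∈g v∈g deg-u deg-w =
  saturated⇒¬anchored-pair {G = G} sat (∣triple∣≡3 u≢w u≢v w≢v) s∉G u≢w (a∈triple u w v) (b∈triple u w v)
    (anchored-of-degree≡2 {G = G} deg-u e∈G u∈e f∈G u∈f (e≢ v∈f) (w , ≢-sym u≢w , b∈triple u w v , w∈e)
                                                           (v , ≢-sym u≢v , c∈triple u w v , v∈f))
    (anchored-of-degree≡2 {G = G} deg-w e∈G w∈e g∈G w∈g (e≢ v∈g) (u , u≢w , a∈triple u w v , u∈e)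
                                                           (v , ≢-sym w≢v , c∈triple u w v , v∈g))
  where
  e≢ : ∀ {h} → v ∈ h → e ≢ h
  e≢ v∈h e≡h = v∉e (subst (v ∈_) (sym e≡h) v∈h)
  s∉G : ¬ triple u w v ∈E G
  s∉G s∈G with degree≡2⇒edge≡⊎≡ {G = G} deg-u e∈G u∈e f∈G u∈f (e≢ v∈f) s∈G (a∈triple u w v)
  ... | inj₁ refl = v∉e (c∈triple u w v)
  ... | inj₂ refl = w∉f (b∈triple u w v)

claim4p4 : Σ ℕ λ N → ∀ (n : ℕ) → n ≥ N → (G : Hyp3 n) → ExtremalSaturated G →
    ∀ (v : Fin n) (e : Subset n) → e ∈E G → v ∉ e →
    ∀ (u w : Fin n) → u ≢ w → u ∈ e → w ∈ e →
    degree G u ≡ 2 → degree G w ≡ 2 → InNbhd G v u → InNbhd G v w → ⊥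
claim4p4 = 7 , λ where
  n 7≤n G (sat , _) v e e∈G v∉e u w u≢w u∈e w∈e deg-u deg-w
    (u≢v , f , f∈G , v∈f , u∈f) (w≢v , g , g∈G , v∈g , w∈g) → case w ∈? f of λ where
      (yes w∈f) → saturated⇒¬degree-2-pair-in-two-edges {G = G} 7≤n sat e∈G f∈G
        (λ e≡f → v∉e (subst (v ∈_) (sym e≡f) v∈f)) u≢w u∈e w∈e u∈f w∈f deg-u deg-w
      (no w∉f) → saturated⇒¬degree-2-pair-with-common-neighbour {G = G} sat e∈G f∈G g∈G
        u≢w u≢v w≢v u∈e w∈e v∉e u∈f v∈f w∉f w∈g v∈g deg-u deg-w
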